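{- Consider the deadline-monotonic partitioning algorithm with the worst-fit strategy (as described in the context), whose schedulability test for assigning a task to a processor is the pair of conditions (A) and (B) below. Its approximation factor for the multiprocessor partitioned packing problem is at least $N/4$, where $N$ is the number of tasks; that is, there are task sets with $N$ tasks on which the number of processors it allocates is at least $\frac{N}{4}M^*$, where $M^*$ is the minimum number of processors in a feasible task partition.
   Context: A sporadic task $\tau_i=(C_i,T_i,D_i)$ has worst-case execution time $C_i>0$, period $T_i>0$, relative deadline $D_i>0$, utilization $u_i=C_i/T_i$, and demand bound function $\mathrm{dbf}(\tau_i,t)=\max\{0,\lfloor (t-D_i)/T_i\rfloor+1\}C_i$. A task set is feasibly scheduled by EDF on one processor iff $\sum_i\mathrm{dbf}(\tau_i,t)\le t$ for all $t\ge0$. A feasible task partition on $M$ processors is a partition of the task set into $M$ disjoint subsets each feasibly scheduled by EDF on one processor; the multiprocessor partitioned packing problem asks to minimize $M$ (optimum $M^*$). Assume $C_i/T_i\le1$ and $C_i/D_i\le1$ for all tasks. Approximate demand bound function: $\mathrm{dbf}^*(\tau_i,t)=0$ if $t<D_i$ and $\mathrm{dbf}^*(\tau_i,t)=\left(\frac{t-D_i}{T_i}+1\right)C_i$ otherwise. Deadline-monotonic (DM) partitioning: index tasks so that $D_i\le D_j$ for $i<j$; put $\tau_1$ on processor 1 (so $M=1$). For $i=2,\dots,N$: call an already allocated processor $m$ (with current assigned set $\mathbf{T}_m\subseteq\{\tau_1,\dots,\tau_{i-1}\}$) admissible if both (A) $C_i+\sum_{\tau_j\in\mathbf{T}_m}\mathrm{dbf}^*(\tau_j,D_i)\le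 D_i$ and (B) $u_i+\sum_{\tau_j\in\mathbf{T}_m}u_j\le 1$ hold. If some processor is admissible, assign $\tau_i$ to an admissible processor chosen by the fitting strategy; otherwise allocate a new processor $M\leftarrow M+1$ and assign $\tau_i$ to it. The worst-fit strategy chooses, among the admissible processors, one with the minimum approximate demand bound $\sum_{\tau_j\in\mathbf{T}_m}\mathrm{dbf}^*(\tau_j,D_i)$ at time $D_i$. -}

module Defs where

open import Data.Nat as ℕ using (ℕ)
open import Data.Integer as ℤ using (ℤ)
open import Data.Rational using (ℚ; 0ℚ; 1ℚ; _+_; _*_; _-_; _÷_; _/_; _≤_; _<_; floor; >-nonZero)
open import Data.Rational.Properties using (_<?_)
open import Data.Fin as Fin using (Fin)
open import Data.List using (List; []; _∷_; _++_; map; foldr; filter; length; lookup; updateAt; allFin)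
open import Data.List.Relation.Unary.All using (All)
open import Data.List.Relation.Unary.Linked using (Linked)
open import Data.List.Relation.Binary.Permutation.Propositional using (_↭_)
open import Data.Product using (_×_; Σ)
open import Relation.Nullary using (¬_; does)
open import Relation.Binary.PropositionalEquality using (_≡_)
open import Data.Bool using (if_then_else_)

record Task : Set where
  field
    C T D : ℚ
    C>0 : 0ℚ < C
    T>0 : 0ℚ < T
    D>0 : 0ℚ < D
    C≤T : C ≤ T
    C≤D : C ≤ D
open Task public

util : Task → ℚ
util τ = _÷_ (C τ) (T τ) {{>-nonZero (T>0 τ)}}

sumℚ : List ℚ → ℚ
sumℚ = foldr _+_ 0ℚ

dbf : Task → ℚ → ℚ
dbf τ t =
  ((ℤ._⊔_ (ℤ.+ 0) (floor (_÷_ (t - D τ) (T τ) {{>-nonZero (T>0 τ)}}) ℤ.+ ℤ.+ 1)) / 1) * C τ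

dbf* : Task → ℚ → ℚ
dbf* τ t =
  if does (t <? D τ) then 0ℚ
  else (_÷_ (t - D τ) (T τ) {{>-nonZero (T>0 τ)}} + 1ℚ) * C τ

-- Uniprocessor EDF feasibility: ∑ dbf(τ,t) ≤ t for all t ≥ 0.
-- (For rational parameters the dbf is a step function with rational
-- jump points, so quantifying over rational t is equivalent to real t.)

EDFFeasible : List Task → Set
EDFFeasible P = ∀ (t : ℚ) → 0ℚ ≤ t → sumℚ (map (λ τ → dbf τ t) P) ≤ t

tasksOn : (ts : List Task) {M : ℕ} → (Fin (length ts) → Fin M) → Fin M → List Task
tasksOn ts σ m = map (lookup ts) (filter (λ i → σ i Fin.≟ m) (allFin (length ts)))

FeasiblePartition : List Task → ℕ → Set
FeasiblePartition ts M =
  Σ (Fin (length ts) → Fin M) λ σ → ∀ (m : Fin M) → EDFFeasible (tasksOn ts σ m)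

IsOptimum : List Task → ℕ → Set
IsOptimum ts M* = FeasiblePartition ts M* × (∀ M → FeasiblePartition ts M → M* ℕ.≤ M)

load : List Task → ℚ → ℚ
load P t = sumℚ (map (λ τ → dbf* τ t) P)

Admissible : Task → List Task → Set
Admissible τ P =
  (C τ + load P (D τ) ≤ D τ) × (util τ + sumℚ (map util P) ≤ 1ℚ)

-- one allocation step of the worst-fit strategy for task τ
-- (relational: any admissible processor of minimum load may be chosen)
data WFStep (τ : Task) : List (List Task) → List (List Task) → Set where
  newProc : ∀ {ps} → All (λ P → ¬ Admissible τ P) ps →
            WFStep τ ps (ps ++ (τ ∷ []) ∷ [])
  assign  : ∀ {ps} (m : Fin (length ps)) →
            Admissible τ (lookup ps m) →
            (∀ (m' : Fin (length ps)) → Admissible τ (lookup ps m') →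
               load (lookup ps m) (D τ) ≤ load (lookup ps m') (D τ)) →
            WFStep τ ps (updateAt ps m (τ ∷_))

data WFRuns : List (List Task) → List Task → List (List Task) → Set where
  done : ∀ {ps} → WFRuns ps [] ps
  step : ∀ {τ ts ps ps' qs} → WFStep τ ps ps' → WFRuns ps' ts qs → WFRuns ps (τ ∷ ts) qs

DMOrdered : List Task → Set
DMOrdered = Linked (λ τ τ' → D τ ≤ D τ')

-- qs is a possible final processor allocation of DM partitioning with
-- worst-fit on the task set ts (any DM ordering of ts, any tie-breaking);
-- the number of allocated processors is length qs.
DMWorstFit : List Task → List (List Task) → Set
DMWorstFit ts qs = Σ (List Task) λ ts' → (ts' ↭ ts) × DMOrdered ts' × WFRuns [] ts' qs

-- Let K = k + 1, R = 8K and, for j < 2K, take the tasks (C, T, D)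
--   aⱼ = ((R − 2)·Rʲ, 2K·R^(j+2), R^(j+1))   and   bⱼ = (2·R^(j+1), 4K·R^(j+1), 4K·R^(j+1)),
-- whose deadlines strictly increase along a₀, b₀, a₁, b₁, …, so this is the only deadline-monotonic
-- order. The N = 4K tasks fit on two processors: the bⱼ have implicit deadlines and total
-- utilisation 1, and the aⱼ have total utilisation at most 1/R while Σ_{i<n} C(aᵢ) ≤ (1 − 1/R)·Rⁿ,
-- so their demand stays below t. Since a₀, b₀, a₁ alone overload one processor at D(a₁), M* = 2.
-- Worst fit, however, opens a processor for every aⱼ: an earlier b_l already contributes approximate
-- demand 4Rʲ at D(aⱼ), while C(aⱼ) = D(aⱼ) − 2Rʲ. Then bⱼ is admissible next to aⱼ, whose processor
-- carries less approximate demand at D(bⱼ) than any processor holding an earlier b_l, so bⱼ goes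
-- there.

module Submission where

open import Defs
open import Data.Nat using (ℕ)

module RationalArithmetic where
  open import Data.Nat as ℕ using (zero; suc)
  import Data.Nat.Properties as ℕ
  open import Data.Integer as ℤ using (0ℤ; 1ℤ)
  import Data.Integer.Properties as ℤ
  import Data.Integer.DivMod as ℤ
  open import Data.Rational
  open import Data.Rational.Properties
  open import Data.Rational.Literals using (fromℤ)
  open import Data.List using ([]; _∷_; _∷ʳ_; map; length)
  open import Data.List.Relation.Unary.All using (All; []; _∷_)
  open import Data.List.Relation.Unary.Any using (here; there)
  open import Data.List.Membership.Propositional using (_∈_)
  open import Function using (_∘_)
  open import Relation.Nullary using (¬_)
  open import Relation.Binary.PropositionalEquality
  open import Data.Rational.Solver
  open +-*-Solver

  q≡p+d⇒p≤q : ∀ {p q d} → 0ℚ ≤ d → q ≡ p + d → p ≤ q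
  q≡p+d⇒p≤q {p} {d = d} 0≤d refl = subst (_≤ p + d) (+-identityʳ p) (+-monoʳ-≤ p 0≤d)

  q≡p+d⇒p<q : ∀ {p q d} → 0ℚ < d → q ≡ p + d → p < q
  q≡p+d⇒p<q {p} {d = d} 0<d refl = subst (_< p + d) (+-identityʳ p) (+-monoʳ-< p 0<d)

  *-nonNeg : ∀ {p q} → 0ℚ ≤ p → 0ℚ ≤ q → 0ℚ ≤ p * q
  *-nonNeg {p} {q} 0≤p 0≤q =
    nonNegative⁻¹ (p * q) {{nonNeg*nonNeg⇒nonNeg p {{nonNegative 0≤p}} q {{nonNegative 0≤q}}}}

  *-pos : ∀ {p q} → 0ℚ < p → 0ℚ < q → 0ℚ < p * q
  *-pos {p} {q} 0<p 0<q = positive⁻¹ (p * q) {{pos*pos⇒pos p {{positive 0<p}} q {{positive 0<q}}}}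

  <⇒≱ : ∀ {p q} → p < q → ¬ q ≤ p
  <⇒≱ p<q q≤p = <-irrefl refl (<-≤-trans p<q q≤p)

  p≤q⇒0≤q-p : ∀ {p q} → p ≤ q → 0ℚ ≤ q - p
  p≤q⇒0≤q-p {p} {q} p≤q = subst (_≤ q - p) (+-inverseʳ p) (+-monoˡ-≤ (- p) p≤q)

  fromℤ-suc : ∀ z → fromℤ (z ℤ.+ 1ℤ) ≡ fromℤ z + 1ℚ
  fromℤ-suc z = begin
    fromℤ (z ℤ.+ 1ℤ)         ≡⟨ ↥p/↧p≡p (fromℤ (z ℤ.+ 1ℤ)) ⟨
    (z ℤ.+ 1ℤ) / 1           ≡⟨ cong (λ w → (w ℤ.+ 1ℤ) / 1) (ℤ.*-identityʳ z) ⟨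
    (z ℤ.* 1ℤ ℤ.+ 1ℤ) / 1   ≡⟨⟩
    fromℤ z + 1ℚ              ∎
    where open ≡-Reasoning

  fromℤ-mono-≤ : ∀ {i j} → i ℤ.≤ j → fromℤ i ≤ fromℤ j
  fromℤ-mono-≤ {i} {j} i≤j = *≤* (subst₂ ℤ._≤_ (sym (ℤ.*-identityʳ i)) (sym (ℤ.*-identityʳ j)) i≤j)

  fromℤ-cancel-< : ∀ {i j} → fromℤ i < fromℤ j → i ℤ.< j
  fromℤ-cancel-< {i} {j} (*<* i<j) = subst₂ ℤ._<_ (ℤ.*-identityʳ i) (ℤ.*-identityʳ j) i<j

  fromℤ-floor≤ : ∀ q → fromℤ (floor q) ≤ q
  fromℤ-floor≤ q@record{} = *≤* (begin
    (↥ q ℤ./ ↧ q) ℤ.* ↧ q  ≤⟨ ℤ.[n/d]*d≤n (↥ q) (↧ q) ⟩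
    ↥ q                    ≡⟨ ℤ.*-identityʳ (↥ q) ⟨
    ↥ q ℤ.* 1ℤ            ∎)
    where open ℤ.≤-Reasoning

  floor-nonNeg : ∀ q → 0ℚ ≤ q → 0ℤ ℤ.≤ floor q
  floor-nonNeg q@record{} 0≤q =
    ℤ.0≤n⇒0≤n/d (↥ q) (↧ q) (ℤ.nonNegative⁻¹ (↥ q) {{nonNegative 0≤q}}) (ℤ.+≤+ ℕ.z≤n)

  floor-neg : ∀ q → q < 0ℚ → floor q ℤ.+ 1ℤ ℤ.≤ 0ℤ
  floor-neg q q<0 = subst (ℤ._≤ 0ℤ) (ℤ.+-comm 1ℤ (floor q))
    (ℤ.i<j⇒suc[i]≤j (fromℤ-cancel-< (≤-<-trans (fromℤ-floor≤ q) q<0)))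

  fromℕ : ℕ → ℚ
  fromℕ n = fromℤ (ℤ.+ n)

  fromℕ-suc : ∀ n → fromℕ (suc n) ≡ fromℕ n + 1ℚ
  fromℕ-suc n = trans (cong (fromℤ ∘ ℤ.+_) (ℕ.+-comm 1 n)) (fromℤ-suc (ℤ.+ n))

  fromℕ-mono-≤ : ∀ {m n} → m ℕ.≤ n → fromℕ m ≤ fromℕ n
  fromℕ-mono-≤ m≤n = fromℤ-mono-≤ (ℤ.+≤+ m≤n)

  fromℕ-nonNeg : ∀ n → 0ℚ ≤ fromℕ n
  fromℕ-nonNeg n = fromℕ-mono-≤ ℕ.z≤n

  fromℕ-+ : ∀ m n → fromℕ (m ℕ.+ n) ≡ fromℕ m + fromℕ n
  fromℕ-+ zero    n = sym (+-identityˡ (fromℕ n))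
  fromℕ-+ (suc m) n = begin
    fromℕ (suc (m ℕ.+ n))        ≡⟨ fromℕ-suc (m ℕ.+ n) ⟩
    fromℕ (m ℕ.+ n) + 1ℚ         ≡⟨ cong (_+ 1ℚ) (fromℕ-+ m n) ⟩
    fromℕ m + fromℕ n + 1ℚ       ≡⟨ solve 2 (λ x y → (x :+ y) :+ con 1ℚ := (x :+ con 1ℚ) :+ y) refl (fromℕ m) (fromℕ n) ⟩
    fromℕ m + 1ℚ + fromℕ n       ≡⟨ cong (_+ fromℕ n) (fromℕ-suc m) ⟨
    fromℕ (suc m) + fromℕ n      ∎
    where open ≡-Reasoning

  sum-nonNeg : ∀ {A : Set} (f : A → ℚ) → (∀ x → 0ℚ ≤ f x) → ∀ xs → 0ℚ ≤ sumℚ (map f xs)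
  sum-nonNeg f f≥0 []       = ≤-refl
  sum-nonNeg f f≥0 (x ∷ xs) = +-mono-≤ (f≥0 x) (sum-nonNeg f f≥0 xs)

  ∈⇒≤sum : ∀ {A : Set} (f : A → ℚ) → (∀ x → 0ℚ ≤ f x) → ∀ {x xs} → x ∈ xs → f x ≤ sumℚ (map f xs)
  ∈⇒≤sum f f≥0 {x} {_ ∷ xs} (here refl) =
    subst (_≤ f x + sumℚ (map f xs)) (+-identityʳ (f x)) (+-monoʳ-≤ (f x) (sum-nonNeg f f≥0 xs))
  ∈⇒≤sum f f≥0 {x} {y ∷ xs} (there x∈xs) =
    subst (_≤ f y + sumℚ (map f xs)) (+-identityˡ (f x)) (+-mono-≤ (f≥0 y) (∈⇒≤sum f f≥0 x∈xs))

  sum-mono-≤ : ∀ {A : Set} {f g : A → ℚ} {xs} → All (λ x → f x ≤ g x) xs → sumℚ (map f xs) ≤ sumℚ (map g xs)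
  sum-mono-≤ []             = ≤-refl
  sum-mono-≤ (fx≤gx ∷ f≤g) = +-mono-≤ fx≤gx (sum-mono-≤ f≤g)

  sum-+ : ∀ {A : Set} (f g : A → ℚ) xs →
          sumℚ (map (λ x → f x + g x) xs) ≡ sumℚ (map f xs) + sumℚ (map g xs)
  sum-+ f g []       = refl
  sum-+ f g (x ∷ xs) = trans (cong ((f x + g x) +_) (sum-+ f g xs))
    (solve 4 (λ a b c d → (a :+ b) :+ (c :+ d) := (a :+ c) :+ (b :+ d)) refl
      (f x) (g x) (sumℚ (map f xs)) (sumℚ (map g xs)))

  sum-*ʳ : ∀ {A : Set} (f : A → ℚ) c xs → sumℚ (map (λ x → f x * c) xs) ≡ sumℚ (map f xs) * c
  sum-*ʳ f c []       = sym (*-zeroˡ c)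
  sum-*ʳ f c (x ∷ xs) = trans (cong (f x * c +_) (sum-*ʳ f c xs)) (sym (*-distribʳ-+ c (f x) _))

  sum-*-≤-length : ∀ {A : Set} (f : A → ℚ) c {xs} → All (λ x → f x * c ≤ 1ℚ) xs →
                   sumℚ (map f xs) * c ≤ fromℕ (length xs)
  sum-*-≤-length f c {[]}     []            = ≤-reflexive (*-zeroˡ c)
  sum-*-≤-length f c {x ∷ xs} (fx*c≤1 ∷ rest) = begin
    (f x + sumℚ (map f xs)) * c       ≡⟨ *-distribʳ-+ c (f x) _ ⟩
    f x * c + sumℚ (map f xs) * c     ≤⟨ +-mono-≤ fx*c≤1 (sum-*-≤-length f c rest) ⟩
    1ℚ + fromℕ (length xs)            ≡⟨ +-comm 1ℚ (fromℕ (length xs)) ⟩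
    fromℕ (length xs) + 1ℚ            ≡⟨ fromℕ-suc (length xs) ⟨
    fromℕ (suc (length xs))           ∎
    where open ≤-Reasoning

  sum-∷ʳ : ∀ {A : Set} (f : A → ℚ) xs x → sumℚ (map f (xs ∷ʳ x)) ≡ sumℚ (map f xs) + f x
  sum-∷ʳ f []       x = trans (+-identityʳ (f x)) (sym (+-identityˡ (f x)))
  sum-∷ʳ f (y ∷ xs) x = trans (cong (f y +_) (sum-∷ʳ f xs x)) (sym (+-assoc (f y) _ (f x)))

module Lists where
  open RationalArithmetic
  open import Data.Nat as ℕ using (zero; suc)
  import Data.Nat.Properties as ℕ
  open import Data.Rational using (ℚ; _≤_; _<_; _+_)
  open import Data.Rational.Properties using (≤-trans; <-trans; <-irrefl)
  open import Data.Fin as Fin using (Fin; zero; suc)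
  open import Data.List using (List; []; _∷_; _∷ʳ_; map; filter; length; lookup; updateAt; tabulate)
  open import Data.List.Relation.Unary.All as All using (All; []; _∷_)
  open import Data.List.Relation.Unary.Any using (here; there)
  open import Data.List.Relation.Unary.Linked using (Linked; []; [-]; _∷_)
  open import Data.List.Relation.Unary.Linked.Properties using (Linked⇒All)
  open import Data.List.Relation.Binary.Permutation.Propositional using (_↭_; ↭-sym)
  open import Data.List.Relation.Binary.Permutation.Propositional.Properties using (∈-resp-↭; drop-∷; ↭-length)
  open import Data.Product using (Σ; _×_; _,_)
  open import Data.Sum using (_⊎_; inj₁; inj₂)
  open import Data.Bool using (true; false; if_then_else_)
  open import Data.Empty using (⊥-elim)
  open import Function using (_∘_)
  open import Relation.Nullary using (does)
  open import Relation.Binary.PropositionalEquality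

  module _ {A : Set} where

    lastPosition : ∀ (xs : List A) x → Σ (Fin (length (xs ∷ʳ x))) λ m → lookup (xs ∷ʳ x) m ≡ x
    lastPosition []       x = zero , refl
    lastPosition (_ ∷ xs) x with lastPosition xs x
    ... | m , eq = suc m , eq

    positions-∷ʳ : ∀ (xs : List A) x (f : A → A) (m : Fin (length (xs ∷ʳ x))) →
      (Σ (Fin (length xs)) λ i → lookup (xs ∷ʳ x) m ≡ lookup xs i) ⊎
      (lookup (xs ∷ʳ x) m ≡ x × updateAt (xs ∷ʳ x) m f ≡ xs ∷ʳ f x)
    positions-∷ʳ []       x f zero    = inj₂ (refl , refl)
    positions-∷ʳ (y ∷ xs) x f zero    = inj₁ (zero , refl)
    positions-∷ʳ (y ∷ xs) x f (suc m) with positions-∷ʳ xs x f m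
    ... | inj₁ (i , eq)      = inj₁ (suc i , eq)
    ... | inj₂ (eq , upd-eq) = inj₂ (eq , cong (y ∷_) upd-eq)

  module _ {A : Set} (key : A → ℚ) where

    private
      Weakly Strictly : List A → Set
      Weakly   = Linked (λ x y → key x ≤ key y)
      Strictly = Linked (λ x y → key x < key y)

      head≤tail : ∀ {x xs} → Weakly (x ∷ xs) → All (λ y → key x ≤ key y) xs
      head≤tail [-]           = []
      head≤tail (x≤y ∷ sorted) = Linked⇒All ≤-trans x≤y sorted

      head<tail : ∀ {x xs} → Strictly (x ∷ xs) → All (λ y → key x < key y) xs
      head<tail [-]           = []
      head<tail (x<y ∷ sorted) = Linked⇒All <-trans x<y sorted

      tail : ∀ {R : A → A → Set} {x xs} → Linked R (x ∷ xs) → Linked R xs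
      tail [-]          = []
      tail (_ ∷ sorted) = sorted

    sorted↭strictlySorted⇒≡ : ∀ {xs ys} → xs ↭ ys → Weakly xs → Strictly ys → xs ≡ ys
    sorted↭strictlySorted⇒≡ {[]} {[]} _ _ _ = refl
    sorted↭strictlySorted⇒≡ {[]} {_ ∷ _} p _ _ with ↭-length p
    ... | ()
    sorted↭strictlySorted⇒≡ {_ ∷ _} {[]} p _ _ with ↭-length p
    ... | ()
    sorted↭strictlySorted⇒≡ {x ∷ xs} {y ∷ ys} p xs↗ ys↗
      with ∈-resp-↭ p (here refl) | ∈-resp-↭ (↭-sym p) (here refl)
    ... | here refl | _ = cong (x ∷_) (sorted↭strictlySorted⇒≡ (drop-∷ p) (tail xs↗) (tail ys↗))
    ... | there x∈ys | here refl = ⊥-elim (<-irrefl refl (All.lookup (head<tail ys↗) x∈ys))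
    ... | there x∈ys | there y∈xs =
      ⊥-elim (<⇒≱ (All.lookup (head<tail ys↗) x∈ys) (All.lookup (head≤tail xs↗) y∈xs))

  private
    lookup-filter-shift : ∀ {A : Set} (x : A) xs {M n} (σ : Fin (suc (length xs)) → Fin M) m (g : Fin n → Fin (length xs)) →
      map (lookup (x ∷ xs)) (filter (λ i → σ i Fin.≟ m) (tabulate (suc ∘ g))) ≡
      map (lookup xs) (filter (λ i → σ (suc i) Fin.≟ m) (tabulate g))
    lookup-filter-shift x xs {n = zero}  σ m g = refl
    lookup-filter-shift x xs {n = suc n} σ m g with does (σ (suc (g zero)) Fin.≟ m)
    ... | true  = cong (lookup xs (g zero) ∷_) (lookup-filter-shift x xs σ m (g ∘ suc))
    ... | false = lookup-filter-shift x xs σ m (g ∘ suc)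

  tasksOn-∷ : ∀ τ ts {M} (σ : Fin (suc (length ts)) → Fin M) m →
    tasksOn (τ ∷ ts) σ m ≡
    (if does (σ zero Fin.≟ m) then τ ∷ tasksOn ts (σ ∘ suc) m else tasksOn ts (σ ∘ suc) m)
  tasksOn-∷ τ ts σ m with does (σ zero Fin.≟ m)
  ... | true  = cong (τ ∷_) (lookup-filter-shift τ ts σ m (λ i → i))
  ... | false = lookup-filter-shift τ ts σ m (λ i → i)

  tasksOn-single : ∀ ts (σ : Fin (length ts) → Fin 1) → tasksOn ts σ zero ≡ ts
  tasksOn-single []       σ = refl
  tasksOn-single (τ ∷ ts) σ with σ zero | tasksOn-∷ τ ts σ zero
  ... | zero | eq = trans eq (cong (τ ∷_) (tasksOn-single ts (σ ∘ suc)))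

  module _ {A : Set} where

    segment : (ℕ → A) → ℕ → ℕ → List A
    segment h j zero    = []
    segment h j (suc n) = h j ∷ segment h (suc j) n

    length-segment : ∀ h j n → length (segment h j n) ≡ n
    length-segment h j zero    = refl
    length-segment h j (suc n) = cong suc (length-segment h (suc j) n)

    segment-∷ʳ : ∀ h j n → segment h j (suc n) ≡ segment h j n ∷ʳ h (j ℕ.+ n)
    segment-∷ʳ h j zero    = cong (λ i → h i ∷ []) (sym (ℕ.+-identityʳ j))
    segment-∷ʳ h j (suc n) = cong (h j ∷_) (trans (segment-∷ʳ h (suc j) n)
                                                   (cong (λ i → segment h (suc j) n ∷ʳ h i) (sym (ℕ.+-suc j n))))

    segment-All : ∀ {P : A → Set} {h} → (∀ i → P (h i)) → ∀ j n → All P (segment h j n)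
    segment-All Ph j zero    = []
    segment-All Ph j (suc n) = Ph j ∷ segment-All Ph (suc j) n

  sum-segment-∷ʳ : ∀ {A : Set} (f : A → ℚ) h n →
                   sumℚ (map f (segment h 0 (suc n))) ≡ sumℚ (map f (segment h 0 n)) + f (h n)
  sum-segment-∷ʳ f h n = trans (cong (λ xs → sumℚ (map f xs)) (segment-∷ʳ h 0 n)) (sum-∷ʳ f (segment h 0 n) (h n))

module DemandBound where
  open RationalArithmetic
  import Data.Nat as ℕ
  open import Data.Integer as ℤ using (0ℤ; 1ℤ)
  import Data.Integer.Properties as ℤ
  open import Data.Rational
  open import Data.Rational.Properties
  open import Data.Rational.Literals using (fromℤ)
  open import Data.List using (map)
  open import Data.List.Relation.Unary.All as All using (All)
  open import Data.Bool using (if_then_else_)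
  open import Relation.Nullary using (yes; no)
  open import Relation.Nullary.Decidable using (dec-true; dec-false)
  open import Relation.Binary.PropositionalEquality
  open import Data.Rational.Solver
  open +-*-Solver

  periodsPast : Task → ℚ → ℚ
  periodsPast τ t = _÷_ (t - D τ) (T τ) {{>-nonZero (T>0 τ)}}

  1/T : Task → ℚ
  1/T τ = (1/ T τ) {{>-nonZero (T>0 τ)}}

  1/T-pos : ∀ τ → 0ℚ < 1/T τ
  1/T-pos τ = positive⁻¹ _ {{1/pos⇒pos (T τ) {{positive (T>0 τ)}}}}

  *1/T*T : ∀ τ p → p * 1/T τ * T τ ≡ p
  *1/T*T τ p = begin
    p * 1/T τ * T τ    ≡⟨ *-assoc p (1/T τ) (T τ) ⟩
    p * (1/T τ * T τ)  ≡⟨ cong (p *_) (*-inverseˡ (T τ) {{>-nonZero (T>0 τ)}}) ⟩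
    p * 1ℚ             ≡⟨ *-identityʳ p ⟩
    p                  ∎
    where open ≡-Reasoning

  util*T≡C : ∀ τ → util τ * T τ ≡ C τ
  util*T≡C τ = *1/T*T τ (C τ)

  periodsPast-neg : ∀ τ {t} → t < D τ → periodsPast τ t < 0ℚ
  periodsPast-neg τ {t} t<D = subst (periodsPast τ t <_) (*-zeroˡ (1/T τ))
    (*-monoˡ-<-pos (1/T τ) {{positive (1/T-pos τ)}}
      (subst (t - D τ <_) (+-inverseʳ (D τ)) (+-monoˡ-< (- D τ) t<D)))

  periodsPast-nonNeg : ∀ τ {t} → D τ ≤ t → 0ℚ ≤ periodsPast τ t
  periodsPast-nonNeg τ D≤t = *-nonNeg (p≤q⇒0≤q-p D≤t) (<⇒≤ (1/T-pos τ))

  dbf-beforeDeadline : ∀ τ {t} → t < D τ → dbf τ t ≡ 0ℚ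
  dbf-beforeDeadline τ {t} t<D = trans
    (cong (λ z → z / 1 * C τ) (ℤ.i≥j⇒i⊔j≡i (floor-neg (periodsPast τ t) (periodsPast-neg τ t<D))))
    (*-zeroˡ (C τ))

  dbf-afterDeadline : ∀ τ {t} → D τ ≤ t → dbf τ t ≡ (fromℤ (floor (periodsPast τ t)) + 1ℚ) * C τ
  dbf-afterDeadline τ {t} D≤t = cong (_* C τ) (begin
    (0ℤ ℤ.⊔ (n ℤ.+ 1ℤ)) / 1  ≡⟨ cong (_/ 1) (ℤ.i≤j⇒i⊔j≡j 0≤n+1) ⟩
    (n ℤ.+ 1ℤ) / 1            ≡⟨ ↥p/↧p≡p (fromℤ (n ℤ.+ 1ℤ)) ⟩
    fromℤ (n ℤ.+ 1ℤ)          ≡⟨ fromℤ-suc n ⟩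
    fromℤ n + 1ℚ               ∎)
    where
    open ≡-Reasoning
    n = floor (periodsPast τ t)
    0≤n+1 : 0ℤ ℤ.≤ n ℤ.+ 1ℤ
    0≤n+1 = ℤ.+-mono-≤ (floor-nonNeg _ (periodsPast-nonNeg τ D≤t)) (ℤ.+≤+ ℕ.z≤n)

  dbf*-beforeDeadline : ∀ τ {t} → t < D τ → dbf* τ t ≡ 0ℚ
  dbf*-beforeDeadline τ {t} t<D =
    cong (λ b → if b then 0ℚ else (periodsPast τ t + 1ℚ) * C τ) (dec-true (t <? D τ) t<D)

  dbf*-afterDeadline : ∀ τ {t} → D τ ≤ t → dbf* τ t ≡ (periodsPast τ t + 1ℚ) * C τ
  dbf*-afterDeadline τ {t} D≤t =
    cong (λ b → if b then 0ℚ else (periodsPast τ t + 1ℚ) * C τ) (dec-false (t <? D τ) (λ t<D → <⇒≱ t<D D≤t))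

  dbf*-afterDeadline-*T : ∀ τ {t} → D τ ≤ t → dbf* τ t * T τ ≡ (t - D τ) * C τ + C τ * T τ
  dbf*-afterDeadline-*T τ {t} D≤t = begin
    dbf* τ t * T τ                             ≡⟨ cong (_* T τ) (dbf*-afterDeadline τ D≤t) ⟩
    ((t - D τ) * 1/T τ + 1ℚ) * C τ * T τ
      ≡⟨ solve 5 (λ x w c T' o → ((x :* w :+ o) :* c) :* T' := x :* w :* T' :* c :+ o :* c :* T')
               refl (t - D τ) (1/T τ) (C τ) (T τ) 1ℚ ⟩
    (t - D τ) * 1/T τ * T τ * C τ + 1ℚ * C τ * T τ
      ≡⟨ cong₂ (λ x y → x * C τ + y * T τ) (*1/T*T τ (t - D τ)) (*-identityˡ (C τ)) ⟩
    (t - D τ) * C τ + C τ * T τ                ∎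
    where open ≡-Reasoning

  dbf≤dbf* : ∀ τ t → dbf τ t ≤ dbf* τ t
  dbf≤dbf* τ t with t <? D τ
  ... | yes t<D = ≤-reflexive (trans (dbf-beforeDeadline τ t<D) (sym (dbf*-beforeDeadline τ t<D)))
  ... | no t≮D = subst₂ _≤_ (sym (dbf-afterDeadline τ D≤t)) (sym (dbf*-afterDeadline τ D≤t))
    (*-monoʳ-≤-nonNeg (C τ) {{nonNegative (<⇒≤ (C>0 τ))}} (+-monoˡ-≤ 1ℚ (fromℤ-floor≤ (periodsPast τ t))))
    where D≤t = ≮⇒≥ t≮D

  C≤dbf : ∀ τ {t} → D τ ≤ t → C τ ≤ dbf τ t
  C≤dbf τ {t} D≤t = subst₂ _≤_ (*-identityˡ (C τ)) (sym (dbf-afterDeadline τ D≤t))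
    (*-monoʳ-≤-nonNeg (C τ) {{nonNegative (<⇒≤ (C>0 τ))}}
      (+-monoˡ-≤ 1ℚ (fromℤ-mono-≤ (floor-nonNeg _ (periodsPast-nonNeg τ D≤t)))))

  dbf-nonNeg : ∀ τ t → 0ℚ ≤ dbf τ t
  dbf-nonNeg τ t with t <? D τ
  ... | yes t<D = ≤-reflexive (sym (dbf-beforeDeadline τ t<D))
  ... | no t≮D = ≤-trans (<⇒≤ (C>0 τ)) (C≤dbf τ (≮⇒≥ t≮D))

  dbf*-nonNeg : ∀ τ t → 0ℚ ≤ dbf* τ t
  dbf*-nonNeg τ t = ≤-trans (dbf-nonNeg τ t) (dbf≤dbf* τ t)

  util-pos : ∀ τ → 0ℚ < util τ
  util-pos τ = *-pos (C>0 τ) (1/T-pos τ)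

  dbf*≤C+util*t : ∀ τ {t} → 0ℚ ≤ t → dbf* τ t ≤ C τ + util τ * t
  dbf*≤C+util*t τ {t} 0≤t with t <? D τ
  ... | yes t<D = subst (_≤ C τ + util τ * t) (sym (dbf*-beforeDeadline τ t<D))
    (+-mono-≤ (<⇒≤ (C>0 τ)) (*-nonNeg (<⇒≤ (util-pos τ)) 0≤t))
  ... | no t≮D = *-cancelʳ-≤-pos (T τ) {{positive (T>0 τ)}} (begin
      dbf* τ t * T τ               ≡⟨ dbf*-afterDeadline-*T τ (≮⇒≥ t≮D) ⟩
      (t - D τ) * C τ + C τ * T τ  ≤⟨ +-monoˡ-≤ (C τ * T τ) (*-monoʳ-≤-nonNeg (C τ) {{nonNegative (<⇒≤ (C>0 τ))}} t-D≤t) ⟩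
      t * C τ + C τ * T τ          ≡⟨ cong (λ c → t * c + C τ * T τ) (util*T≡C τ) ⟨
      t * (util τ * T τ) + C τ * T τ
        ≡⟨ solve 4 (λ u T' t c → t :* (u :* T') :+ c :* T' := (c :+ u :* t) :* T') refl (util τ) (T τ) t (C τ) ⟩
      (C τ + util τ * t) * T τ     ∎)
    where
    open ≤-Reasoning
    t-D≤t : t - D τ ≤ t
    t-D≤t = q≡p+d⇒p≤q (<⇒≤ (D>0 τ)) (solve 2 (λ t d → t := (t :- d) :+ d) refl t (D τ))

  sum-dbf≤ : ∀ P {t} → 0ℚ ≤ t → sumℚ (map (λ τ → dbf τ t) P) ≤ sumℚ (map C P) + sumℚ (map util P) * t
  sum-dbf≤ P {t} 0≤t = begin
    sumℚ (map (λ τ → dbf τ t) P)                ≤⟨ sum-mono-≤ {xs = P} (All.tabulate (λ {τ} _ → ≤-trans (dbf≤dbf* τ t) (dbf*≤C+util*t τ 0≤t))) ⟩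
    sumℚ (map (λ τ → C τ + util τ * t) P)       ≡⟨ sum-+ C (λ τ → util τ * t) P ⟩
    sumℚ (map C P) + sumℚ (map (λ τ → util τ * t) P) ≡⟨ cong (sumℚ (map C P) +_) (sum-*ʳ util t P) ⟩
    sumℚ (map C P) + sumℚ (map util P) * t      ∎
    where open ≤-Reasoning

  dbf*-implicitDeadline-*T : ∀ τ {t} → D τ ≡ T τ → D τ ≤ t → dbf* τ t * T τ ≡ t * C τ
  dbf*-implicitDeadline-*T τ {t} D≡T D≤t = begin
    dbf* τ t * T τ               ≡⟨ dbf*-afterDeadline-*T τ D≤t ⟩
    (t - D τ) * C τ + C τ * T τ  ≡⟨ cong (λ d → (t - D τ) * C τ + C τ * d) D≡T ⟨
    (t - D τ) * C τ + C τ * D τ  ≡⟨ solve 3 (λ t d c → (t :- d) :* c :+ c :* d := t :* c) refl t (D τ) (C τ) ⟩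
    t * C τ                      ∎
    where open ≡-Reasoning

  dbf*≤util*t : ∀ τ {t} → D τ ≡ T τ → 0ℚ ≤ t → dbf* τ t ≤ util τ * t
  dbf*≤util*t τ {t} D≡T 0≤t with t <? D τ
  ... | yes t<D = subst (_≤ util τ * t) (sym (dbf*-beforeDeadline τ t<D)) (*-nonNeg (<⇒≤ (util-pos τ)) 0≤t)
  ... | no t≮D = *-cancelʳ-≤-pos (T τ) {{positive (T>0 τ)}} (≤-reflexive (begin
      dbf* τ t * T τ      ≡⟨ dbf*-implicitDeadline-*T τ D≡T (≮⇒≥ t≮D) ⟩
      t * C τ             ≡⟨ cong (t *_) (util*T≡C τ) ⟨
      t * (util τ * T τ)  ≡⟨ solve 3 (λ t u T' → t :* (u :* T') := u :* t :* T') refl t (util τ) (T τ) ⟩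
      util τ * t * T τ    ∎))
    where open ≡-Reasoning

  implicitDeadlines-feasible : ∀ {P} → All (λ τ → D τ ≡ T τ) P → sumℚ (map util P) ≤ 1ℚ → EDFFeasible P
  implicitDeadlines-feasible {P} implicit U≤1 t 0≤t = begin
    sumℚ (map (λ τ → dbf τ t) P)        ≤⟨ sum-mono-≤ {xs = P} (All.map (λ {τ} D≡T → ≤-trans (dbf≤dbf* τ t) (dbf*≤util*t τ D≡T 0≤t)) implicit) ⟩
    sumℚ (map (λ τ → util τ * t) P)     ≡⟨ sum-*ʳ util t P ⟩
    sumℚ (map util P) * t               ≤⟨ *-monoʳ-≤-nonNeg t {{nonNegative 0≤t}} U≤1 ⟩
    1ℚ * t                              ≡⟨ *-identityˡ t ⟩
    t                                   ∎
    where open ≤-Reasoning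

  util*≤1 : ∀ τ {x} → C τ * x ≤ T τ → util τ * x ≤ 1ℚ
  util*≤1 τ {x} Cx≤T = *-cancelʳ-≤-pos (T τ) {{positive (T>0 τ)}} (begin
    util τ * x * T τ    ≡⟨ solve 3 (λ u x T' → u :* x :* T' := u :* T' :* x) refl (util τ) x (T τ) ⟩
    util τ * T τ * x    ≡⟨ cong (_* x) (util*T≡C τ) ⟩
    C τ * x             ≤⟨ Cx≤T ⟩
    T τ                 ≡⟨ *-identityˡ (T τ) ⟨
    1ℚ * T τ            ∎)
    where open ≤-Reasoning

module WorstFit where
  open RationalArithmetic
  open Lists
  open DemandBound
  open import Data.Nat as ℕ using (zero; suc)
  import Data.Nat.Properties as ℕ
  open import Data.Rational using (_<_; _≤_; _+_)
  open import Data.Fin using (Fin; zero; suc; toℕ)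
  open import Data.List.Relation.Unary.Linked using (Linked; []; [-]; _∷_)
  open import Function using (_∘_)
  open import Data.Rational.Properties using (≤-trans; <-≤-trans; +-monoʳ-≤)
  open import Data.List using (List; []; _∷_; _∷ʳ_; length; lookup)
  open import Data.List.Properties using (length-++)
  open import Data.List.Relation.Unary.All as All using (All; []; _∷_)
  open import Data.List.Relation.Unary.All.Properties using (++⁻ʳ; ∷ʳ⁺)
  open import Data.List.Relation.Unary.Any using (here)
  open import Data.List.Membership.Propositional using (_∈_)
  open import Data.List.Membership.Propositional.Properties using (∈-lookup)
  open import Data.Product using (Σ; _×_; _,_; proj₁; proj₂)
  open import Data.Sum using (inj₁; inj₂)
  open import Data.Empty using (⊥-elim)
  open import Relation.Nullary using (¬_)
  open import Relation.Binary.PropositionalEquality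

  load-∋ : ∀ {τ P} t → τ ∈ P → dbf* τ t ≤ load P t
  load-∋ t = ∈⇒≤sum (λ τ → dbf* τ t) (λ τ → dbf*-nonNeg τ t)

  pairs : (ℕ → Task) → (ℕ → Task) → ℕ → ℕ → List Task
  pairs a b j zero    = []
  pairs a b j (suc n) = a j ∷ b j ∷ pairs a b (suc j) n

  pairs-sorted : ∀ {a b : ℕ → Task} → (∀ j → D (a j) < D (b j)) → (∀ j → D (b j) < D (a (suc j))) →
                 ∀ j n → Linked (λ τ τ′ → D τ < D τ′) (pairs a b j n)
  pairs-sorted Da<Db Db<Da j zero          = []
  pairs-sorted Da<Db Db<Da j (suc zero)    = Da<Db j ∷ [-]
  pairs-sorted Da<Db Db<Da j (suc (suc n)) = Da<Db j ∷ Db<Da j ∷ pairs-sorted Da<Db Db<Da (suc j) (suc n)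

  parity : ℕ → Fin 2
  parity zero          = zero
  parity (suc zero)    = suc zero
  parity (suc (suc n)) = parity n

  module _ (a b : ℕ → Task) where

    tasksOn-pairs-even : ∀ j n → tasksOn (pairs a b j n) (parity ∘ toℕ) zero ≡ segment a j n
    tasksOn-pairs-even j zero    = refl
    tasksOn-pairs-even j (suc n) = trans (tasksOn-∷ (a j) _ (parity ∘ toℕ) zero)
      (cong (a j ∷_) (trans (tasksOn-∷ (b j) _ (parity ∘ toℕ ∘ suc) zero) (tasksOn-pairs-even (suc j) n)))

    tasksOn-pairs-odd : ∀ j n → tasksOn (pairs a b j n) (parity ∘ toℕ) (suc zero) ≡ segment b j n
    tasksOn-pairs-odd j zero    = refl
    tasksOn-pairs-odd j (suc n) = trans (tasksOn-∷ (a j) _ (parity ∘ toℕ) (suc zero))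
      (trans (tasksOn-∷ (b j) _ (parity ∘ toℕ ∘ suc) (suc zero)) (cong (b j ∷_) (tasksOn-pairs-odd (suc j) n)))

    length-pairs : ∀ j n → length (pairs a b j n) ≡ n ℕ.+ n
    length-pairs j zero    = refl
    length-pairs j (suc n) = cong suc (trans (cong suc (length-pairs (suc j) n)) (sym (ℕ.+-suc n n)))

  module WorstFitOnPairs
    (a b : ℕ → Task)
    (a-blocked : ∀ {l j} → l ℕ.< j → D (a j) < C (a j) + dbf* (b l) (D (a j)))
    (b-fits : ∀ j → Admissible (b j) (a j ∷ []))
    (b-prefers : ∀ {l j} → l ℕ.< j → load (a j ∷ []) (D (b j)) < dbf* (b l) (D (b j)))
    where

    HoldsEarlierB : ℕ → List Task → Set
    HoldsEarlierB j P = Σ ℕ λ l → l ℕ.< j × b l ∈ P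

    a-notAdmissible : ∀ {j P} → HoldsEarlierB j P → ¬ Admissible (a j) P
    a-notAdmissible {j} (l , l<j , bₗ∈P) (fitsA , _) =
      <⇒≱ (a-blocked l<j) (≤-trans (+-monoʳ-≤ (C (a j)) (load-∋ (D (a j)) bₗ∈P)) fitsA)

    a-opensProcessor : ∀ {j ps ps′} → All (HoldsEarlierB j) ps → WFStep (a j) ps ps′ →
                       ps′ ≡ ps ∷ʳ (a j ∷ [])
    a-opensProcessor hold (newProc _)       = refl
    a-opensProcessor hold (assign m adm _) = ⊥-elim (a-notAdmissible (All.lookup hold (∈-lookup m)) adm)

    b-joinsA : ∀ {j ps ps′} → All (HoldsEarlierB j) ps → WFStep (b j) (ps ∷ʳ (a j ∷ [])) ps′ →
               ps′ ≡ ps ∷ʳ (b j ∷ a j ∷ [])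
    b-joinsA {j} {ps} hold (newProc none) = ⊥-elim (All.head (++⁻ʳ ps none) (b-fits j))
    b-joinsA {j} {ps} hold (assign m _ minimal) with positions-∷ʳ ps (a j ∷ []) (b j ∷_) m
    ... | inj₂ (_ , updated) = updated
    ... | inj₁ (i , m↦i) with All.lookup hold (∈-lookup i)
    ... | l , l<j , bₗ∈P = ⊥-elim (<⇒≱ (<-≤-trans (b-prefers l<j) (load-∋ (D (b j)) bₗ∈P)) chosen≤last)
      where
      last = lastPosition ps (a j ∷ [])
      chosen≤last : load (lookup ps i) (D (b j)) ≤ load (a j ∷ []) (D (b j))
      chosen≤last = subst₂ (λ P Q → load P (D (b j)) ≤ load Q (D (b j))) m↦i (proj₂ last)
        (minimal (proj₁ last) (subst (Admissible (b j)) (sym (proj₂ last)) (b-fits j)))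

    worstFit-onePerPair : ∀ n {j ps qs} → All (HoldsEarlierB j) ps → WFRuns ps (pairs a b j n) qs →
                          length qs ≡ length ps ℕ.+ n
    worstFit-onePerPair zero    hold done = sym (ℕ.+-identityʳ _)
    worstFit-onePerPair (suc n) {j} {ps} {qs} hold (step stepA (step stepB run))
      with a-opensProcessor hold stepA
    ... | refl with b-joinsA hold stepB
    ... | refl = begin
      length qs                                      ≡⟨ worstFit-onePerPair n hold′ run ⟩
      length (ps ∷ʳ (b j ∷ a j ∷ [])) ℕ.+ n          ≡⟨ cong (ℕ._+ n) (length-++ ps) ⟩
      length ps ℕ.+ 1 ℕ.+ n                          ≡⟨ ℕ.+-assoc (length ps) 1 n ⟩
      length ps ℕ.+ suc n                            ∎
      where
      open ≡-Reasoning
      hold′ : All (HoldsEarlierB (suc j)) (ps ∷ʳ (b j ∷ a j ∷ []))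
      hold′ = ∷ʳ⁺ (All.map (λ (l , l<j , bₗ∈P) → l , ℕ.m≤n⇒m≤1+n l<j , bₗ∈P) hold)
                  (j , ℕ.≤-refl , here refl)

module Construction (k : ℕ) where
  open RationalArithmetic
  open Lists
  open DemandBound
  open WorstFit
  open import Data.Nat as ℕ using (zero; suc)
  import Data.Nat.Properties as ℕ
  open import Data.Rational
  open import Data.Rational.Properties
  open import Data.List using (List; []; _∷_; map; length)
  open import Data.Product using (_,_)
  open import Data.List.Relation.Unary.All using ([])
  open import Relation.Binary.PropositionalEquality
  open import Relation.Nullary using (¬_; yes; no; contradiction)
  open import Data.Fin using (zero; suc; toℕ)
  open import Function using (_∘_)
  open import Data.Nat.Tactic.RingSolver using (solve-∀)
  open import Data.Rational.Solver
  open +-*-Solver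

  -- Each inequality between the task parameters is polynomial in κ = k ≥ 0. It is proved by writing
  -- the larger side as the smaller one plus a polynomial with nonnegative coefficients, given as a
  -- Horner coefficient list; the identity is checked by the ring solver on the solver-syntax images
  -- ⟨…⟩ of the definitions below.
  horner : List ℕ → ℚ → ℚ
  horner []       x = 0ℚ
  horner (c ∷ cs) x = fromℕ c + x * horner cs x

  horner-nonNeg : ∀ cs {x} → 0ℚ ≤ x → 0ℚ ≤ horner cs x
  horner-nonNeg []       0≤x = ≤-refl
  horner-nonNeg (c ∷ cs) 0≤x = +-mono-≤ (fromℕ-nonNeg c) (*-nonNeg 0≤x (horner-nonNeg cs 0≤x))

  horner-pos : ∀ c cs {x} → 0ℚ ≤ x → 0ℚ < horner (suc c ∷ cs) x
  horner-pos c cs 0≤x = +-mono-<-≤ (positive⁻¹ (fromℕ (suc c))) (*-nonNeg 0≤x (horner-nonNeg cs 0≤x))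

  ⟨horner⟩ : ∀ {n} → List ℕ → Polynomial n → Polynomial n
  ⟨horner⟩ []       x = con 0ℚ
  ⟨horner⟩ (c ∷ cs) x = con (fromℕ c) :+ x :* ⟨horner⟩ cs x

  ⟨K⟩ ⟨R⟩ : ∀ {n} → Polynomial n → Polynomial n
  ⟨K⟩ κ = κ :+ con 1ℚ
  ⟨R⟩ κ = con (fromℕ 8) :* ⟨K⟩ κ

  ⟨Ca⟩ ⟨Ta⟩ ⟨Da⟩ ⟨Cb⟩ ⟨Db⟩ : ∀ {n} → Polynomial n → Polynomial n → Polynomial n
  ⟨Ca⟩ κ p = (⟨R⟩ κ :- con (fromℕ 2)) :* p
  ⟨Ta⟩ κ p = con (fromℕ 2) :* ⟨K⟩ κ :* (⟨R⟩ κ :* (⟨R⟩ κ :* p))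
  ⟨Da⟩ κ p = ⟨R⟩ κ :* p
  ⟨Cb⟩ κ p = con (fromℕ 2) :* (⟨R⟩ κ :* p)
  ⟨Db⟩ κ p = con (fromℕ 4) :* ⟨K⟩ κ :* (⟨R⟩ κ :* p)

  κ K R : ℚ
  κ = fromℕ k
  K = κ + 1ℚ
  R = fromℕ 8 * K

  0≤κ : 0ℚ ≤ κ
  0≤κ = fromℕ-nonNeg k

  0<K : 0ℚ < K
  0<K = +-mono-≤-< 0≤κ (positive⁻¹ 1ℚ)

  0<R : 0ℚ < R
  0<R = *-pos (positive⁻¹ (fromℕ 8)) 0<K

  0<2K : 0ℚ < fromℕ 2 * K
  0<2K = *-pos (positive⁻¹ (fromℕ 2)) 0<K

  0<R-2 : 0ℚ < R - fromℕ 2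
  0<R-2 = q≡p+d⇒p<q (horner-pos 5 (8 ∷ []) 0≤κ)
    (solve 1 (λ κ → ⟨R⟩ κ :- con (fromℕ 2) := con 0ℚ :+ ⟨horner⟩ (6 ∷ 8 ∷ []) κ) refl κ)

  infix 8 R^_
  R^_ : ℕ → ℚ
  R^ zero  = 1ℚ
  R^ suc j = R * R^ j

  0<R^ : ∀ j → 0ℚ < R^ j
  0<R^ zero    = positive⁻¹ 1ℚ
  0<R^ (suc j) = *-pos 0<R (0<R^ j)

  0≤R^ : ∀ j → 0ℚ ≤ R^ j
  0≤R^ j = <⇒≤ (0<R^ j)

  R^-mono : ∀ {i j} → i ℕ.≤ j → R^ i ≤ R^ j
  R^-mono {zero}  {zero}  _           = ≤-refl
  R^-mono {zero}  {suc j} _           = ≤-trans (R^-mono {zero} {j} ℕ.z≤n) (R^-step j)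
    where
    R^-step : ∀ j → R^ j ≤ R^ suc j
    R^-step j = q≡p+d⇒p≤q (*-nonNeg (horner-nonNeg (7 ∷ 8 ∷ []) 0≤κ) (0≤R^ j))
      (solve 2 (λ κ p → ⟨R⟩ κ :* p := p :+ ⟨horner⟩ (7 ∷ 8 ∷ []) κ :* p) refl κ (R^ j))
  R^-mono {suc i} {suc j} (ℕ.s≤s i≤j) = *-monoˡ-≤-nonNeg R {{nonNegative (<⇒≤ 0<R)}} (R^-mono i≤j)

  a : ℕ → Task
  a j = record
    { C   = (R - fromℕ 2) * R^ j
    ; T   = fromℕ 2 * K * (R * (R * R^ j))
    ; D   = R * R^ j
    ; C>0 = *-pos 0<R-2 (0<R^ j)
    ; T>0 = *-pos 0<2K (*-pos 0<R (*-pos 0<R (0<R^ j)))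
    ; D>0 = *-pos 0<R (0<R^ j)
    ; C≤T = q≡p+d⇒p≤q (*-nonNeg (horner-nonNeg (122 ∷ 376 ∷ 384 ∷ 128 ∷ []) 0≤κ) (0≤R^ j))
              (solve 2 (λ κ p → ⟨Ta⟩ κ p := ⟨Ca⟩ κ p :+ ⟨horner⟩ (122 ∷ 376 ∷ 384 ∷ 128 ∷ []) κ :* p) refl κ (R^ j))
    ; C≤D = q≡p+d⇒p≤q (*-nonNeg (fromℕ-nonNeg 2) (0≤R^ j))
              (solve 2 (λ κ p → ⟨Da⟩ κ p := ⟨Ca⟩ κ p :+ con (fromℕ 2) :* p) refl κ (R^ j))
    }

  b : ℕ → Task
  b j = record
    { C   = fromℕ 2 * (R * R^ j)
    ; T   = fromℕ 4 * K * (R * R^ j)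
    ; D   = fromℕ 4 * K * (R * R^ j)
    ; C>0 = *-pos (positive⁻¹ (fromℕ 2)) (*-pos 0<R (0<R^ j))
    ; T>0 = 0<Db
    ; D>0 = 0<Db
    ; C≤T = Cb≤Db
    ; C≤D = Cb≤Db
    }
    where
    0<Db : 0ℚ < fromℕ 4 * K * (R * R^ j)
    0<Db = *-pos (*-pos (positive⁻¹ (fromℕ 4)) 0<K) (*-pos 0<R (0<R^ j))
    Cb≤Db : fromℕ 2 * (R * R^ j) ≤ fromℕ 4 * K * (R * R^ j)
    Cb≤Db = q≡p+d⇒p≤q (*-nonNeg (horner-nonNeg (16 ∷ 48 ∷ 32 ∷ []) 0≤κ) (0≤R^ j))
      (solve 2 (λ κ p → ⟨Db⟩ κ p := ⟨Cb⟩ κ p :+ ⟨horner⟩ (16 ∷ 48 ∷ 32 ∷ []) κ :* p) refl κ (R^ j))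

  Da<Db : ∀ j → D (a j) < D (b j)
  Da<Db j = q≡p+d⇒p<q (*-pos (horner-pos 23 (56 ∷ 32 ∷ []) 0≤κ) (0<R^ j))
    (solve 2 (λ κ p → ⟨Db⟩ κ p := ⟨Da⟩ κ p :+ ⟨horner⟩ (24 ∷ 56 ∷ 32 ∷ []) κ :* p) refl κ (R^ j))

  Db<Da : ∀ j → D (b j) < D (a (suc j))
  Db<Da j = q≡p+d⇒p<q (*-pos (horner-pos 31 (64 ∷ 32 ∷ []) 0≤κ) (0<R^ j))
    (solve 2 (λ κ p → ⟨Da⟩ κ (⟨R⟩ κ :* p) := ⟨Db⟩ κ p :+ ⟨horner⟩ (32 ∷ 64 ∷ 32 ∷ []) κ :* p) refl κ (R^ j))

  Da-mono : ∀ {i j} → i ℕ.≤ j → D (a i) ≤ D (a j)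
  Da-mono i≤j = *-monoˡ-≤-nonNeg R {{nonNegative (<⇒≤ 0<R)}} (R^-mono i≤j)

  Db-mono : ∀ {i j} → i ℕ.≤ j → D (b i) ≤ D (b j)
  Db-mono i≤j = *-monoˡ-≤-nonNeg (fromℕ 4 * K) {{nonNegative (<⇒≤ (*-pos (positive⁻¹ (fromℕ 4)) 0<K))}}
    (*-monoˡ-≤-nonNeg R {{nonNegative (<⇒≤ 0<R)}} (R^-mono i≤j))

  Db≤Da : ∀ {l j} → l ℕ.< j → D (b l) ≤ D (a j)
  Db≤Da {l} l<j = ≤-trans (<⇒≤ (Db<Da l)) (Da-mono l<j)

  2KR : ℚ
  2KR = fromℕ 2 * K * R

  0<2KR : 0ℚ < 2KR
  0<2KR = *-pos 0<2K 0<R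

  util-a*2KR≤1 : ∀ j → util (a j) * 2KR ≤ 1ℚ
  util-a*2KR≤1 j = util*≤1 (a j) (q≡p+d⇒p≤q (*-nonNeg (horner-nonNeg (32 ∷ 64 ∷ 32 ∷ []) 0≤κ) (0≤R^ j))
    (solve 2 (λ κ p → ⟨Ta⟩ κ p := ⟨Ca⟩ κ p :* (con (fromℕ 2) :* ⟨K⟩ κ :* ⟨R⟩ κ) :+ ⟨horner⟩ (32 ∷ 64 ∷ 32 ∷ []) κ :* p)
      refl κ (R^ j)))

  util-b*2K≤1 : ∀ j → util (b j) * (fromℕ 2 * K) ≤ 1ℚ
  util-b*2K≤1 j = util*≤1 (b j) (≤-reflexive
    (solve 2 (λ κ p → ⟨Cb⟩ κ p :* (con (fromℕ 2) :* ⟨K⟩ κ) := ⟨Db⟩ κ p) refl κ (R^ j)))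

  dbf*-a-at-Db : ∀ j → dbf* (a j) (D (b j)) ≤ R * R^ j
  dbf*-a-at-Db j = begin
    dbf* (a j) (D (b j))                              ≤⟨ dbf*≤C+util*t (a j) (<⇒≤ (D>0 (b j))) ⟩
    C (a j) + util (a j) * D (b j)                    ≡⟨ cong (λ x → C (a j) + util (a j) * x) Db≡2KR*2Rʲ ⟩
    C (a j) + util (a j) * (2KR * (fromℕ 2 * R^ j))   ≡⟨ cong (C (a j) +_) (*-assoc (util (a j)) 2KR _) ⟨
    C (a j) + util (a j) * 2KR * (fromℕ 2 * R^ j)     ≤⟨ +-monoʳ-≤ (C (a j)) (*-monoʳ-≤-nonNeg (fromℕ 2 * R^ j)
                                                           {{nonNegative (*-nonNeg (fromℕ-nonNeg 2) (0≤R^ j))}} (util-a*2KR≤1 j)) ⟩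
    C (a j) + 1ℚ * (fromℕ 2 * R^ j)                   ≡⟨ solve 2 (λ κ p → ⟨Ca⟩ κ p :+ con 1ℚ :* (con (fromℕ 2) :* p) := ⟨R⟩ κ :* p)
                                                           refl κ (R^ j) ⟩
    R * R^ j                                          ∎
    where
    open ≤-Reasoning
    Db≡2KR*2Rʲ : D (b j) ≡ 2KR * (fromℕ 2 * R^ j)
    Db≡2KR*2Rʲ = solve 2 (λ κ p → ⟨Db⟩ κ p := con (fromℕ 2) :* ⟨K⟩ κ :* ⟨R⟩ κ :* (con (fromℕ 2) :* p)) refl κ (R^ j)

  a-blocked : ∀ {l j} → l ℕ.< j → D (a j) < C (a j) + dbf* (b l) (D (a j))
  a-blocked {l} {j} l<j = subst (_< C (a j) + dbf* (b l) (D (a j)))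
    (solve 2 (λ κ p → ⟨Ca⟩ κ p :+ con (fromℕ 2) :* p := ⟨Da⟩ κ p) refl κ (R^ j))
    (+-monoʳ-< (C (a j)) 2P<dbf*)
    where
    2P<dbf* : fromℕ 2 * R^ j < dbf* (b l) (D (a j))
    2P<dbf* = *-cancelʳ-<-nonNeg (T (b l)) {{nonNegative (<⇒≤ (T>0 (b l)))}}
      (subst (fromℕ 2 * R^ j * T (b l) <_) (sym (dbf*-implicitDeadline-*T (b l) refl (Db≤Da l<j)))
        (q≡p+d⇒p<q (*-pos (*-pos (horner-pos 63 (128 ∷ 64 ∷ []) 0≤κ) (0<R^ j)) (0<R^ l))
          (solve 3 (λ κ p q → ⟨Da⟩ κ p :* ⟨Cb⟩ κ q
                                := con (fromℕ 2) :* p :* ⟨Db⟩ κ q :+ ⟨horner⟩ (64 ∷ 128 ∷ 64 ∷ []) κ :* p :* q)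
            refl κ (R^ j) (R^ l))))

  b-fits : ∀ j → Admissible (b j) (a j ∷ [])
  b-fits j = demand , utilization
    where
    demand : C (b j) + (dbf* (a j) (D (b j)) + 0ℚ) ≤ D (b j)
    demand = ≤-trans (+-monoʳ-≤ (C (b j)) (+-monoˡ-≤ 0ℚ (dbf*-a-at-Db j)))
      (q≡p+d⇒p≤q (*-nonNeg (horner-nonNeg (8 ∷ 40 ∷ 32 ∷ []) 0≤κ) (0≤R^ j))
        (solve 2 (λ κ p → ⟨Db⟩ κ p := (⟨Cb⟩ κ p :+ (⟨R⟩ κ :* p :+ con 0ℚ)) :+ ⟨horner⟩ (8 ∷ 40 ∷ 32 ∷ []) κ :* p)
          refl κ (R^ j)))
    utilization : util (b j) + (util (a j) + 0ℚ) ≤ 1ℚ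
    utilization = *-cancelʳ-≤-pos 2KR {{positive 0<2KR}} (begin
      (util (b j) + (util (a j) + 0ℚ)) * 2KR
        ≡⟨ solve 3 (λ κ u v → (u :+ (v :+ con 0ℚ)) :* (con (fromℕ 2) :* ⟨K⟩ κ :* ⟨R⟩ κ)
                               := u :* (con (fromℕ 2) :* ⟨K⟩ κ) :* ⟨R⟩ κ :+ v :* (con (fromℕ 2) :* ⟨K⟩ κ :* ⟨R⟩ κ))
             refl κ (util (b j)) (util (a j)) ⟩
      util (b j) * (fromℕ 2 * K) * R + util (a j) * 2KR
        ≤⟨ +-mono-≤ (*-monoʳ-≤-nonNeg R {{nonNegative (<⇒≤ 0<R)}} (util-b*2K≤1 j)) (util-a*2KR≤1 j) ⟩
      1ℚ * R + 1ℚ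
        ≤⟨ q≡p+d⇒p≤q (horner-nonNeg (7 ∷ 24 ∷ 16 ∷ []) 0≤κ)
             (solve 1 (λ κ → con 1ℚ :* (con (fromℕ 2) :* ⟨K⟩ κ :* ⟨R⟩ κ)
                             := (con 1ℚ :* ⟨R⟩ κ :+ con 1ℚ) :+ ⟨horner⟩ (7 ∷ 24 ∷ 16 ∷ []) κ) refl κ) ⟩
      1ℚ * 2KR ∎)
      where open ≤-Reasoning

  b-prefers : ∀ {l j} → l ℕ.< j → load (a j ∷ []) (D (b j)) < dbf* (b l) (D (b j))
  b-prefers {l} {j} l<j = begin-strict
    dbf* (a j) (D (b j)) + 0ℚ   ≤⟨ +-monoˡ-≤ 0ℚ (dbf*-a-at-Db j) ⟩
    R * R^ j + 0ℚ               <⟨ q≡p+d⇒p<q (*-pos 0<R (0<R^ j))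
                                     (solve 2 (λ κ p → ⟨Cb⟩ κ p := (⟨R⟩ κ :* p :+ con 0ℚ) :+ ⟨R⟩ κ :* p) refl κ (R^ j)) ⟩
    C (b j)                     ≤⟨ *-cancelʳ-≤-pos (T (b l)) {{positive (T>0 (b l))}} (≤-reflexive (begin-equality
      C (b j) * T (b l)           ≡⟨ solve 3 (λ κ p q → ⟨Cb⟩ κ p :* ⟨Db⟩ κ q := ⟨Db⟩ κ p :* ⟨Cb⟩ κ q) refl κ (R^ j) (R^ l) ⟩
      D (b j) * C (b l)           ≡⟨ dbf*-implicitDeadline-*T (b l) refl (Db-mono (ℕ.<⇒≤ l<j)) ⟨
      dbf* (b l) (D (b j)) * T (b l) ∎)) ⟩
    dbf* (b l) (D (b j))        ∎
    where open ≤-Reasoning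

  N : ℕ
  N = suc (suc (k ℕ.+ k))

  fromℕ-N : fromℕ N ≡ fromℕ 2 * K
  fromℕ-N = begin
    fromℕ (suc (suc (k ℕ.+ k)))   ≡⟨ fromℕ-suc (suc (k ℕ.+ k)) ⟩
    fromℕ (suc (k ℕ.+ k)) + 1ℚ    ≡⟨ cong (_+ 1ℚ) (fromℕ-suc (k ℕ.+ k)) ⟩
    fromℕ (k ℕ.+ k) + 1ℚ + 1ℚ     ≡⟨ cong (λ x → x + 1ℚ + 1ℚ) (fromℕ-+ k k) ⟩
    κ + κ + 1ℚ + 1ℚ               ≡⟨ solve 1 (λ κ → κ :+ κ :+ con 1ℚ :+ con 1ℚ := con (fromℕ 2) :* ⟨K⟩ κ) refl κ ⟩
    fromℕ 2 * K                   ∎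
    where open ≡-Reasoning

  ΣCa : ℕ → ℚ
  ΣCa n = sumℚ (map C (segment a 0 n))

  R*ΣCa+R^n≤R*R^n : ∀ n → R * ΣCa n + R^ n ≤ R * R^ n
  R*ΣCa+R^n≤R*R^n zero    = q≡p+d⇒p≤q (horner-nonNeg (7 ∷ 8 ∷ []) 0≤κ)
    (solve 1 (λ κ → ⟨R⟩ κ :* con 1ℚ := ⟨R⟩ κ :* con 0ℚ :+ con 1ℚ :+ ⟨horner⟩ (7 ∷ 8 ∷ []) κ) refl κ)
  R*ΣCa+R^n≤R*R^n (suc n) = begin
    R * ΣCa (suc n) + R^ suc n                        ≡⟨ cong (λ x → R * x + R^ suc n) (sum-segment-∷ʳ C a n) ⟩
    R * (ΣCa n + C (a n)) + R * R^ n                  ≤⟨ q≡p+d⇒p≤q (+-mono-≤ (p≤q⇒0≤q-p (R*ΣCa+R^n≤R*R^n n)) (0≤R^ n))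
         (solve 3 (λ κ g p → ⟨R⟩ κ :* (⟨R⟩ κ :* p)
                             := (⟨R⟩ κ :* (g :+ ⟨Ca⟩ κ p) :+ ⟨R⟩ κ :* p) :+ ((⟨R⟩ κ :* p :- (⟨R⟩ κ :* g :+ p)) :+ p))
           refl κ (ΣCa n) (R^ n)) ⟩
    R * R^ suc n                                      ∎
    where open ≤-Reasoning

  Σutil-a*2KR≤2K : ∀ n → n ℕ.≤ N → sumℚ (map util (segment a 0 n)) * 2KR ≤ fromℕ 2 * K
  Σutil-a*2KR≤2K n n≤N = begin
    sumℚ (map util (segment a 0 n)) * 2KR ≤⟨ sum-*-≤-length util 2KR (segment-All util-a*2KR≤1 0 n) ⟩
    fromℕ (length (segment a 0 n))       ≡⟨ cong fromℕ (length-segment a 0 n) ⟩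
    fromℕ n                              ≤⟨ fromℕ-mono-≤ n≤N ⟩
    fromℕ N                              ≡⟨ fromℕ-N ⟩
    fromℕ 2 * K                          ∎
    where open ≤-Reasoning

  a-prefix-demand≤ : ∀ n → suc n ℕ.≤ N → ∀ {t} → D (a n) ≤ t → sumℚ (map (λ τ → dbf τ t) (segment a 0 (suc n))) ≤ t
  a-prefix-demand≤ n n<N {t} D≤t = *-cancelʳ-≤-pos 2KR {{positive 0<2KR}} (begin
    sumℚ (map (λ τ → dbf τ t) seg) * 2KR   ≤⟨ *-monoʳ-≤-nonNeg 2KR {{nonNegative (<⇒≤ 0<2KR)}} (sum-dbf≤ seg 0≤t) ⟩
    (ΣCa (suc n) + U * t) * 2KR            ≡⟨ solve 4 (λ g u t x → (g :+ u :* t) :* x := x :* g :+ u :* x :* t)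
                                              refl (ΣCa (suc n)) U t 2KR ⟩
    2KR * ΣCa (suc n) + U * 2KR * t        ≤⟨ +-monoʳ-≤ (2KR * ΣCa (suc n))
                                              (*-monoʳ-≤-nonNeg t {{nonNegative 0≤t}} (Σutil-a*2KR≤2K (suc n) n<N)) ⟩
    2KR * ΣCa (suc n) + fromℕ 2 * K * t    ≤⟨ q≡p+d⇒p≤q
         (+-mono-≤ (*-nonNeg (<⇒≤ 0<2K) (p≤q⇒0≤q-p (R*ΣCa+R^n≤R*R^n (suc n))))
                   (*-nonNeg (*-nonNeg (<⇒≤ 0<2K) (horner-nonNeg (7 ∷ 8 ∷ []) 0≤κ)) (p≤q⇒0≤q-p D≤t)))
         (solve 4 (λ κ g p t → t :* (con (fromℕ 2) :* ⟨K⟩ κ :* ⟨R⟩ κ)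
              := (con (fromℕ 2) :* ⟨K⟩ κ :* ⟨R⟩ κ :* g :+ con (fromℕ 2) :* ⟨K⟩ κ :* t)
                 :+ (con (fromℕ 2) :* ⟨K⟩ κ :* (⟨R⟩ κ :* p :- (⟨R⟩ κ :* g :+ p))
                     :+ con (fromℕ 2) :* ⟨K⟩ κ :* ⟨horner⟩ (7 ∷ 8 ∷ []) κ :* (t :- p)))
           refl κ (ΣCa (suc n)) (R^ suc n) t) ⟩
    t * 2KR                                ∎)
    where
    open ≤-Reasoning
    seg = segment a 0 (suc n)
    U = sumℚ (map util seg)
    0≤t = ≤-trans (<⇒≤ (D>0 (a n))) D≤t

  a-prefix-feasible : ∀ n → n ℕ.≤ N → EDFFeasible (segment a 0 n)
  a-prefix-feasible zero    _   t 0≤t = 0≤t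
  a-prefix-feasible (suc n) n<N t 0≤t with t <? D (a n)
  ... | no t≮D  = a-prefix-demand≤ n n<N (≮⇒≥ t≮D)
  ... | yes t<D = begin
    Σdbf (segment a 0 (suc n))         ≡⟨ sum-segment-∷ʳ (λ τ → dbf τ t) a n ⟩
    Σdbf (segment a 0 n) + dbf (a n) t ≡⟨ cong (Σdbf (segment a 0 n) +_) (dbf-beforeDeadline (a n) t<D) ⟩
    Σdbf (segment a 0 n) + 0ℚ          ≡⟨ +-identityʳ _ ⟩
    Σdbf (segment a 0 n)               ≤⟨ a-prefix-feasible n (ℕ.<⇒≤ n<N) t 0≤t ⟩
    t                                  ∎
    where
    open ≤-Reasoning
    Σdbf : List Task → ℚ
    Σdbf P = sumℚ (map (λ τ → dbf τ t) P)

  b-segment-feasible : EDFFeasible (segment b 0 N)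
  b-segment-feasible = implicitDeadlines-feasible (segment-All (λ _ → refl) 0 N)
    (*-cancelʳ-≤-pos (fromℕ 2 * K) {{positive 0<2K}} (begin
      sumℚ (map util (segment b 0 N)) * (fromℕ 2 * K)  ≤⟨ sum-*-≤-length util _ (segment-All util-b*2K≤1 0 N) ⟩
      fromℕ (length (segment b 0 N))                   ≡⟨ cong fromℕ (length-segment b 0 N) ⟩
      fromℕ N                                          ≡⟨ fromℕ-N ⟩
      fromℕ 2 * K                                      ≡⟨ *-identityˡ _ ⟨
      1ℚ * (fromℕ 2 * K)                               ∎))
    where open ≤-Reasoning

  tasks : List Task
  tasks = pairs a b 0 N

  length-tasks : length tasks ≡ 4 ℕ.* suc k
  length-tasks = trans (length-pairs a b 0 N) (N+N≡4[1+k] k)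
    where
    N+N≡4[1+k] : ∀ k → suc (suc (k ℕ.+ k)) ℕ.+ suc (suc (k ℕ.+ k)) ≡ 4 ℕ.* suc k
    N+N≡4[1+k] = solve-∀

  twoProcessors : FeasiblePartition tasks 2
  twoProcessors = parity ∘ toℕ , feasible
    where
    feasible : ∀ m → EDFFeasible (tasksOn tasks (parity ∘ toℕ) m)
    feasible zero       = subst EDFFeasible (sym (tasksOn-pairs-even a b 0 N)) (a-prefix-feasible N ℕ.≤-refl)
    feasible (suc zero) = subst EDFFeasible (sym (tasksOn-pairs-odd a b 0 N)) b-segment-feasible

  oneProcessor-infeasible : ¬ EDFFeasible tasks
  oneProcessor-infeasible feasible = <⇒≱ overload (≤-trans demand (feasible t (<⇒≤ (D>0 (a 1)))))
    where
    t = D (a 1)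
    f = λ τ → dbf τ t
    rest = pairs a b 2 (k ℕ.+ k)
    demand : C (a 0) + (C (b 0) + (C (a 1) + 0ℚ)) ≤ f (a 0) + (f (b 0) + (f (a 1) + sumℚ (map f (b 1 ∷ rest))))
    demand = +-mono-≤ (C≤dbf (a 0) (Da-mono {0} {1} ℕ.z≤n))
               (+-mono-≤ (C≤dbf (b 0) (Db≤Da {0} {1} (ℕ.s≤s ℕ.z≤n)))
                 (+-mono-≤ (C≤dbf (a 1) ≤-refl) (sum-nonNeg f (λ τ → dbf-nonNeg τ t) (b 1 ∷ rest))))
    overload : t < C (a 0) + (C (b 0) + (C (a 1) + 0ℚ))
    overload = q≡p+d⇒p<q (horner-pos 5 (8 ∷ []) 0≤κ)
      (solve 1 (λ κ → ⟨Ca⟩ κ (con 1ℚ) :+ (⟨Cb⟩ κ (con 1ℚ) :+ (⟨Ca⟩ κ (⟨R⟩ κ :* con 1ℚ) :+ con 0ℚ))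
                      := ⟨Da⟩ κ (⟨R⟩ κ :* con 1ℚ) :+ ⟨horner⟩ (6 ∷ 8 ∷ []) κ) refl κ)

  atLeastTwoProcessors : ∀ M → FeasiblePartition tasks M → 2 ℕ.≤ M
  atLeastTwoProcessors zero             (σ , _)        with σ zero
  ... | ()
  atLeastTwoProcessors (suc zero)       (σ , feasible) =
    contradiction (subst EDFFeasible (tasksOn-single tasks σ) (feasible zero)) oneProcessor-infeasible
  atLeastTwoProcessors (suc (suc M))    _              = ℕ.s≤s (ℕ.s≤s ℕ.z≤n)

  open WorstFitOnPairs a b a-blocked b-fits b-prefers

  worstFit-processors : ∀ qs → DMWorstFit tasks qs → length qs ≡ N
  worstFit-processors qs (ts′ , ts′↭tasks , dm-ordered , run) =
    worstFit-onePerPair N {0} {[]} {qs} [] (subst (λ ts → WFRuns [] ts qs) ts′≡tasks run)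
    where
    ts′≡tasks : ts′ ≡ tasks
    ts′≡tasks = sorted↭strictlySorted⇒≡ D ts′↭tasks dm-ordered (pairs-sorted Da<Db Db<Da 0 N)

open import Data.Nat using (ℕ; _*_; _≤_)
open import Data.List using (List; length)
open import Data.Product using (Σ; _×_)
open import Relation.Binary.PropositionalEquality using (_≡_)
open import Data.Nat using (zero; suc; _+_; z≤n)
open import Data.Nat.Properties using (≤-reflexive)
open import Data.Nat.Tactic.RingSolver using (solve-∀)
open import Data.List using ([])
open import Data.Product using (_,_)
open import Relation.Binary.PropositionalEquality using (refl; cong; module ≡-Reasoning)
open WorstFit using (length-pairs)

mainTheorem3 : ∀ (K : ℕ) → Σ (List Task) λ ts → (length ts ≡ 4 * K) ×
                 Σ ℕ λ Mopt → IsOptimum ts Mopt ×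
                 (∀ qs → DMWorstFit ts qs → length ts * Mopt ≤ 4 * length qs)
mainTheorem3 zero    = [] , refl , 0 , (((λ ()) , (λ ())) , (λ _ _ → z≤n)) , (λ _ _ → z≤n)
mainTheorem3 (suc k) = tasks , length-tasks , 2 , (twoProcessors , atLeastTwoProcessors) , ratio
  where
  open Construction k

  ratio : ∀ qs → DMWorstFit tasks qs → length tasks * 2 ≤ 4 * length qs
  ratio qs wf = ≤-reflexive (begin
    length tasks * 2   ≡⟨ cong (_* 2) (length-pairs a b 0 N) ⟩
    (N + N) * 2        ≡⟨ [n+n]*2≡4*n N ⟩
    4 * N              ≡⟨ cong (4 *_) (worstFit-processors qs wf) ⟨
    4 * length qs      ∎)
    where
    open ≡-Reasoning
    [n+n]*2≡4*n : ∀ n → (n + n) * 2 ≡ 4 * n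
    [n+n]*2≡4*n = solve-∀
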